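{- Let $R$ be a ring and let $\{N_1,\dots,N_k\}$ be a collection of ideals of $R$ satisfying the CNC-condition, and let $s_i$ be the characteristic of $N_i$ in $N_{i+1}$ ($i=1,\dots,k-1$). Let $w$ be a natural number and $f\in R$ with $(f+N_1)^w = 1+N_1$ in $R/N_1$. Then $x^{w s_1 s_2\cdots s_{k-1}}=1$ for all $x\in f+N_1$. Moreover, if $w$ is the multiplicative order of $f+N_1$ in $R/N_1$, then the multiplicative order of every $x\in f+N_1$ divides $w s_1 s_2\cdots s_{k-1}$.
   Context: Rings are associative with identity, not necessarily commutative. The multiplicative order $o(x)$ of an element $x$ is the least natural number $m\ge 1$ with $x^m=1$ (if it exists). A collection $\{N_1,\dots,N_k\}$ of ideals of $R$ satisfies the CNC-condition if: (i) $\{0\}=N_k\subset N_{k-1}\subset\cdots\subset N_1\subset R$; (ii) for each $i=1,\dots,k-1$ there is $t_i\ge 2$ with $N_i^{t_i}\subset N_{i+1}$ (the minimal such $t_i$ is the nilpotency index of $N_i$ in $N_{i+1}$); (iii) for each $i=1,\dots,k-1$ there is $s_i\ge 1$ with $s_iN_i\subset N_{i+1}$ and all prime factors of $s_i$ are $\ge t_i$; the minimal such $s_i$ is called the characteristic of $N_i$ in $N_{i+1}$. -}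

module Defs where

open import Level using (Level; _⊔_)
open import Algebra.Bundles using (Ring)
import Algebra.Bundles
open import Data.Nat as ℕ using (ℕ; zero; suc; _≤_; _∸_)
open import Data.Nat.Divisibility using (_∣_)
open import Data.Nat.Primality using (Prime)
open import Data.Vec using (Vec; foldr)
open import Data.Vec.Relation.Unary.All using (All)
open import Data.Product using (Σ; _×_; ∃; ∃-syntax)
open import Relation.Unary using (Pred)
import Algebra.Definitions.RawSemiring as RS

∏₁ : (ℕ → ℕ) → ℕ → ℕ
∏₁ s zero    = 1
∏₁ s (suc n) = ∏₁ s n ℕ.* s (suc n)

module RingDefs {c ℓ} (R : Ring c ℓ) where
  open Ring R public
  open RS (Algebra.Bundles.Semiring.rawSemiring semiring) public using () renaming (_×_ to _·_; _^_ to _^_)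

  record IsIdeal {ℓ'} (I : Pred Carrier ℓ') : Set (c ⊔ ℓ ⊔ ℓ') where
    field
      resp  : ∀ {x y} → x ≈ y → I x → I y
      zero∈ : I 0#
      +-cl  : ∀ {x y} → I x → I y → I (x + y)
      neg-cl : ∀ {x} → I x → I (- x)
      *ˡ-cl : ∀ r {x} → I x → I (r * x)
      *ʳ-cl : ∀ r {x} → I x → I (x * r)

  _⊆_ : ∀ {ℓ₁ ℓ₂} → Pred Carrier ℓ₁ → Pred Carrier ℓ₂ → Set (c ⊔ ℓ₁ ⊔ ℓ₂)
  I ⊆ J = ∀ {x} → I x → J x

  vprod : ∀ {n} → Vec Carrier n → Carrier
  vprod = foldr _ _*_ 1#

  ProdOf : ∀ {ℓ'} → Pred Carrier ℓ' → ℕ → Pred Carrier (c ⊔ ℓ ⊔ ℓ')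
  ProdOf N t x = Σ (Vec Carrier t) λ v → All N v × (vprod v ≈ x)

  -- the ideal power N^t : all finite sums of products of t elements of N
  -- (this is the additive subgroup generated by such products, which is already
  --  an ideal when N is an ideal, since -(a₁⋯aₜ) = (-a₁)a₂⋯aₜ)
  data Pow {ℓ'} (N : Pred Carrier ℓ') (t : ℕ) : Pred Carrier (c ⊔ ℓ ⊔ ℓ') where
    pz : ∀ {x} → x ≈ 0# → Pow N t x
    ps : ∀ {a y x} → ProdOf N t a → Pow N t y → x ≈ a + y → Pow N t x

  _·ideal_⊆_ : ∀ {ℓ₁ ℓ₂} → ℕ → Pred Carrier ℓ₁ → Pred Carrier ℓ₂ → Set (c ⊔ ℓ₁ ⊔ ℓ₂)
  s ·ideal N ⊆ M = ∀ {x} → N x → M (s · x)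

  PrimeFactorsGE : ℕ → ℕ → Set
  PrimeFactorsGE s t = ∀ p → Prime p → p ∣ s → t ≤ p

  -- CNC-condition for N₁,…,Nₖ (indices 1..k of the family N; other indices unused)
  record CNC {ℓ'} (k : ℕ) (N : ℕ → Pred Carrier ℓ') : Set (c ⊔ ℓ ⊔ ℓ') where
    field
      k≥1     : 1 ≤ k
      ideal   : ∀ i → 1 ≤ i → i ≤ k → IsIdeal (N i)
      Nk-zero : ∀ x → N k x → x ≈ 0#
      Nk-has0 : ∀ x → x ≈ 0# → N k x
      chain   : ∀ i → 1 ≤ i → i ℕ.< k → N (suc i) ⊆ N i
      nil     : ∀ i → 1 ≤ i → i ℕ.< k →
                  ∃[ t ] (2 ≤ t × Pow (N i) t ⊆ N (suc i))
      char    : ∀ i → 1 ≤ i → i ℕ.< k →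
                  ∃[ t ] (2 ≤ t × Pow (N i) t ⊆ N (suc i) ×
                    ∃[ s ] (1 ≤ s × s ·ideal N i ⊆ N (suc i) × PrimeFactorsGE s t))

  record IsNilIndex {ℓ₁ ℓ₂} (N : Pred Carrier ℓ₁) (M : Pred Carrier ℓ₂) (t : ℕ)
         : Set (c ⊔ ℓ ⊔ ℓ₁ ⊔ ℓ₂) where
    field
      t≥2   : 2 ≤ t
      pow⊆  : Pow N t ⊆ M
      least : ∀ t' → 2 ≤ t' → Pow N t' ⊆ M → t ≤ t'

  record IsCharacteristic {ℓ₁ ℓ₂} (N : Pred Carrier ℓ₁) (M : Pred Carrier ℓ₂) (s : ℕ)
         : Set (c ⊔ ℓ ⊔ ℓ₁ ⊔ ℓ₂) where
    field
      t       : ℕ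
      nilIdx  : IsNilIndex N M t
      s≥1     : 1 ≤ s
      s⊆      : s ·ideal N ⊆ M
      primes  : PrimeFactorsGE s t
      least   : ∀ s' → 1 ≤ s' → s' ·ideal N ⊆ M → PrimeFactorsGE s' t → s ≤ s'

  record IsOrder (x : Carrier) (m : ℕ) : Set ℓ where
    field
      m≥1   : 1 ≤ m
      pow1  : x ^ m ≈ 1#
      least : ∀ m' → 1 ≤ m' → x ^ m' ≈ 1# → m ≤ m'

  -- (f + I)^w = 1 + I in R/I,  i.e.  f^w - 1 ∈ I
  PowOneMod : ∀ {ℓ'} → Pred Carrier ℓ' → Carrier → ℕ → Set ℓ'
  PowOneMod I f w = I (f ^ w - 1#)

  record IsOrderMod {ℓ'} (I : Pred Carrier ℓ') (f : Carrier) (m : ℕ) : Set (c ⊔ ℓ') where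
    field
      m≥1   : 1 ≤ m
      pow1  : PowOneMod I f m
      least : ∀ m' → 1 ≤ m' → PowOneMod I f m' → m ≤ m'

  InCoset : ∀ {ℓ'} → Pred Carrier ℓ' → Carrier → Carrier → Set (c ⊔ ℓ ⊔ ℓ')
  InCoset I f x = ∃[ n ] (I n × x ≈ f + n)

-- Let s = sᵢ, let t be the nilpotency index of Nᵢ in Nᵢ₊₁, and write y = 1 + a with a ∈ Nᵢ.
-- By the binomial theorem y^s − 1 = Σ_{j ≥ 1} C(s,j) a^j. A term with j ≥ t lies in
-- Nᵢ^t ⊆ Nᵢ₊₁. A term with 1 ≤ j < t has s ∣ C(s,j), because j·C(s,j) = s·C(s−1,j−1) and
-- every prime factor of s is ≥ t > j; so it lies in s·Nᵢ ⊆ Nᵢ₊₁. Hence y − 1 ∈ Nᵢ implies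
-- y^s − 1 ∈ Nᵢ₊₁. Starting from x^w − 1 ∈ N₁ and climbing the chain gives
-- x^(w s₁⋯sₖ₋₁) − 1 ∈ Nₖ = 0, and the order of x divides any exponent killing x.
module Submission where

open import Defs
open import Algebra.Bundles using (Ring)
open import Data.Nat using (ℕ; suc; _∸_; _≤_; _<_) renaming (_*_ to _ℕ*_)
open import Data.Nat.Divisibility using (_∣_; divides; ∣-trans; m∣m*n; ∣⇒≤; 0∣⇒≡0; m%n≡0⇒n∣m)
open import Data.Product using (_×_; _,_; ∃-syntax)
open import Relation.Unary using (Pred)

open import Data.Nat as ℕ using (zero; NonZero; _%_; _/_)
open import Data.Nat.Properties as ℕ using ()
open import Data.Nat.DivMod using (m≡m%n+[m/n]*n; m%n<n)
open import Data.Nat.Combinatorics using (_C_; nC1≡n; nCk+nC[k+1]≡[n+1]C[k+1])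
open import Data.Nat.Coprimality using (Coprime; coprime-divisor)
open import Data.Nat.Primality using (Prime)
open import Data.Nat.Primality.Factorisation using (factorise)
open import Data.List using ([]; _∷_)
open import Data.Nat.ListAction using (product)
open import Data.List.Relation.Unary.All using (_∷_)
open import Data.Vec.Relation.Unary.All using ([]; _∷_)
open import Data.Fin using (toℕ) renaming (zero to fzero; suc to fsuc)
open import Data.Vec using ([]; _∷_)
open import Data.Vec.Functional using (Vector)
open import Relation.Nullary using (yes; no; contradiction)
open import Relation.Binary.PropositionalEquality as ≡ using (_≡_; _≢_)

[1+k]*[1+n]C[1+k]≡[1+n]*nCk : ∀ n k → suc k ℕ* (suc n C suc k) ≡ suc n ℕ* (n C k)
[1+k]*[1+n]C[1+k]≡[1+n]*nCk zero    zero    = ≡.refl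
[1+k]*[1+n]C[1+k]≡[1+n]*nCk zero    (suc k) = ℕ.*-zeroʳ (suc (suc k))
[1+k]*[1+n]C[1+k]≡[1+n]*nCk (suc n) zero    =
  ≡.trans (ℕ.+-identityʳ _) (≡.trans (nC1≡n (suc (suc n))) (≡.sym (ℕ.*-identityʳ (suc (suc n)))))
[1+k]*[1+n]C[1+k]≡[1+n]*nCk (suc n) (suc k) = begin
  suc (suc k) ℕ* (suc (suc n) C suc (suc k))
    ≡⟨ ≡.cong (suc (suc k) ℕ*_) (nCk+nC[k+1]≡[n+1]C[k+1] (suc n) (suc k)) ⟨
  suc (suc k) ℕ* (A ℕ.+ B)
    ≡⟨ ℕ.*-distribˡ-+ (suc (suc k)) A B ⟩
  (A ℕ.+ suc k ℕ* A) ℕ.+ suc (suc k) ℕ* B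
    ≡⟨ ≡.cong₂ (λ u v → (A ℕ.+ u) ℕ.+ v) ([1+k]*[1+n]C[1+k]≡[1+n]*nCk n k)
                                          ([1+k]*[1+n]C[1+k]≡[1+n]*nCk n (suc k)) ⟩
  (A ℕ.+ suc n ℕ* c) ℕ.+ suc n ℕ* d
    ≡⟨ ℕ.+-assoc A (suc n ℕ* c) (suc n ℕ* d) ⟩
  A ℕ.+ (suc n ℕ* c ℕ.+ suc n ℕ* d)
    ≡⟨ ≡.cong (A ℕ.+_) (ℕ.*-distribˡ-+ (suc n) c d) ⟨
  A ℕ.+ suc n ℕ* (c ℕ.+ d)
    ≡⟨ ≡.cong (λ u → A ℕ.+ suc n ℕ* u) (nCk+nC[k+1]≡[n+1]C[k+1] n k) ⟩
  A ℕ.+ suc n ℕ* A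
    ∎
  where
  open ≡.≡-Reasoning
  A B c d : ℕ
  A = suc n C suc k
  B = suc n C suc (suc k)
  c = n C k
  d = n C suc k

prime-divisor : ∀ n .{{_ : NonZero n}} → n ≢ 1 → ∃[ p ] Prime p × p ∣ n
prime-divisor n n≢1 with factorise n
... | record { factors = [] ; isFactorisation = n≡1 } = contradiction n≡1 n≢1
... | record { factors = p ∷ ps ; isFactorisation = n≡p*Πps ; factorsPrime = prime[p] ∷ _ } =
  p , prime[p] , ≡.subst (p ∣_) (≡.sym n≡p*Πps) (m∣m*n (product ps))

primeFactors≥⇒coprime : ∀ {s t j} .{{_ : NonZero j}} →
  (∀ p → Prime p → p ∣ s → t ≤ p) → j < t → Coprime s j
primeFactors≥⇒coprime {j = j} _ _ {zero} (_ , 0∣j) = contradiction (0∣⇒≡0 0∣j) (ℕ.≢-nonZero⁻¹ j)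
primeFactors≥⇒coprime primeFactors≥t j<t {d@(suc _)} (d∣s , d∣j) with d ℕ.≟ 1
... | yes d≡1 = d≡1
... | no d≢1 with prime-divisor d d≢1
...   | p , prime[p] , p∣d =
  contradiction (ℕ.≤-trans (primeFactors≥t p prime[p] (∣-trans p∣d d∣s)) (∣⇒≤ (∣-trans p∣d d∣j)))
                (ℕ.<⇒≱ j<t)

primeFactors≥⇒n∣nCk : ∀ {s t j} → (∀ p → Prime p → p ∣ s → t ≤ p) → 1 ≤ j → j < t → s ∣ s C j
primeFactors≥⇒n∣nCk {zero}  {j = suc k} _ _ _ = divides 0 ≡.refl
primeFactors≥⇒n∣nCk {suc n} {j = suc k} primeFactors≥t _ j<t =
  coprime-divisor (primeFactors≥⇒coprime primeFactors≥t j<t)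
    (divides (n C k) (≡.trans ([1+k]*[1+n]C[1+k]≡[1+n]*nCk n k) (ℕ.*-comm (suc n) (n C k))))

module _ {c ℓ} (R : Ring c ℓ) where
  open RingDefs R
  open import Algebra.Properties.Ring R using (x[y-z]≈xy-xz)
  open import Algebra.Properties.Group +-group
    using (//-rightDividesˡ; //-rightDividesʳ; \\-leftDividesʳ; x∙y⁻¹≈ε⇒x≈y)
  open import Algebra.Properties.Semiring.Exp semiring using (^-congˡ; ^-congʳ; ^-homo-*; ^-assocʳ)
  open import Algebra.Properties.Semiring.Mult semiring using (×-assocˡ; ×-congˡ)
  open import Algebra.Properties.Semiring.Sum semiring using (sum)
  import Algebra.Properties.Semiring.Binomial semiring as Binomial
  open import Relation.Binary.Reasoning.Setoid setoid

  1#^n≈1# : ∀ n → 1# ^ n ≈ 1#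
  1#^n≈1# zero    = refl
  1#^n≈1# (suc n) = trans (*-identityˡ _) (1#^n≈1# n)

  module IdealProperties {ℓ'} {I : Pred Carrier ℓ'} (isIdeal : IsIdeal I) where
    open IsIdeal isIdeal

    ·-closed : ∀ n {x} → I x → I (n · x)
    ·-closed zero    _  = zero∈
    ·-closed (suc n) Ix = +-cl Ix (·-closed n Ix)

    sum-closed : ∀ {n} (g : Vector Carrier n) → (∀ i → I (g i)) → I (sum g)
    sum-closed {zero}  g Ig = zero∈
    sum-closed {suc n} g Ig = +-cl (Ig fzero) (sum-closed (λ i → g (fsuc i)) (λ i → Ig (fsuc i)))

    diff-trans : ∀ {a b d} → I (a - b) → I (b - d) → I (a - d)
    diff-trans {a} {b} {d} I[a-b] I[b-d] = resp a-b+b-d≈a-d (+-cl I[a-b] I[b-d])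
      where
      a-b+b-d≈a-d : (a - b) + (b - d) ≈ a - d
      a-b+b-d≈a-d = trans (+-assoc a (- b) (b - d)) (+-congˡ (\\-leftDividesʳ b (- d)))

    coset-^-diff : ∀ f {n} → I n → ∀ w → I ((f + n) ^ w - f ^ w)
    coset-^-diff f {n} In zero    = resp (sym (-‿inverseʳ 1#)) zero∈
    coset-^-diff f {n} In (suc w) =
      resp expand (+-cl (*ˡ-cl f (coset-^-diff f In w)) (*ʳ-cl X In))
      where
      X F : Carrier
      X = (f + n) ^ w
      F = f ^ w
      expand : f * (X - F) + n * X ≈ (f + n) * X - f * F
      expand = begin
        f * (X - F) + n * X         ≈⟨ +-congʳ (x[y-z]≈xy-xz f X F) ⟩
        (f * X - f * F) + n * X     ≈⟨ +-assoc (f * X) (- (f * F)) (n * X) ⟩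
        f * X + (- (f * F) + n * X) ≈⟨ +-congˡ (+-comm (- (f * F)) (n * X)) ⟩
        f * X + (n * X - f * F)     ≈⟨ +-assoc (f * X) (n * X) (- (f * F)) ⟨
        (f * X + n * X) - f * F     ≈⟨ +-congʳ (distribʳ X f n) ⟨
        (f + n) * X - f * F         ∎

    PowOneMod-coset : ∀ {f x} w → PowOneMod I f w → InCoset I f x → PowOneMod I x w
    PowOneMod-coset {f} {x} w fʷ-1∈I (n , n∈I , x≈f+n) =
      resp (+-congʳ (^-congˡ w (sym x≈f+n))) (diff-trans (coset-^-diff f n∈I w) fʷ-1∈I)

  open IdealProperties public

  ^∈ProdOf : ∀ {ℓ'} {N : Pred Carrier ℓ'} {a} → N a → ∀ t → ProdOf N t (a ^ t)
  ^∈ProdOf Na zero = [] , [] , refl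
  ^∈ProdOf Na (suc t) with ^∈ProdOf Na t
  ... | v , Nv , Πv≈aᵗ = _ ∷ v , Na ∷ Nv , *-congˡ Πv≈aᵗ

  ^∈Pow : ∀ {ℓ'} {N : Pred Carrier ℓ'} {a} → N a → ∀ t → Pow N t (a ^ t)
  ^∈Pow Na t = Pow.ps (^∈ProdOf Na t) (Pow.pz refl) (sym (+-identityʳ _))

  module _ {ℓ₁ ℓ₂} {N : Pred Carrier ℓ₁} {M : Pred Carrier ℓ₂}
           (N-ideal : IsIdeal N) (M-ideal : IsIdeal M) {t s : ℕ}
           (Nᵗ⊆M : Pow N t ⊆ M) (sN⊆M : s ·ideal N ⊆ M) (primeFactors≥t : PrimeFactorsGE s t) where
    open IsIdeal M-ideal

    t≤j⇒aʲ∈M : ∀ {a j} → N a → t ≤ j → M (a ^ j)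
    t≤j⇒aʲ∈M {a} {j} Na t≤j = resp aᵗ*aʲ⁻ᵗ≈aʲ (*ʳ-cl (a ^ (j ∸ t)) (Nᵗ⊆M (^∈Pow Na t)))
      where
      aᵗ*aʲ⁻ᵗ≈aʲ : a ^ t * a ^ (j ∸ t) ≈ a ^ j
      aᵗ*aʲ⁻ᵗ≈aʲ = trans (sym (^-homo-* a t (j ∸ t))) (^-congʳ a (ℕ.m+[n∸m]≡n t≤j))

    binomialTerm∈M : ∀ {a} b → N a → ∀ j → M ((s C suc j) · (a ^ suc j * b))
    binomialTerm∈M {a} b Na j with t ℕ.≤? suc j
    ... | yes t≤j = ·-closed M-ideal (s C suc j) (*ʳ-cl b (t≤j⇒aʲ∈M Na t≤j))
    ... | no  t≰j with primeFactors≥⇒n∣nCk primeFactors≥t (ℕ.s≤s ℕ.z≤n) (ℕ.≰⇒> t≰j)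
    ...   | divides q sCj≡q*s = resp q·s·z≈sCj·z (·-closed M-ideal q (sN⊆M aʲb∈N))
      where
      aʲb∈N : N (a ^ suc j * b)
      aʲb∈N = IsIdeal.*ʳ-cl N-ideal b (IsIdeal.*ʳ-cl N-ideal (a ^ j) Na)
      q·s·z≈sCj·z : q · (s · (a ^ suc j * b)) ≈ (s C suc j) · (a ^ suc j * b)
      q·s·z≈sCj·z = trans (×-assocˡ _ q s) (×-congˡ (≡.sym sCj≡q*s))

    y-1∈N⇒yˢ-1∈M : ∀ {y} → N (y - 1#) → M (y ^ s - 1#)
    y-1∈N⇒yˢ-1∈M {y} y-1∈N =
      resp ΣT≈yˢ-1 (sum-closed M-ideal T (λ i → binomialTerm∈M _ y-1∈N (toℕ i)))
      where
      a : Carrier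
      a = y - 1#
      open Binomial a 1# using (binomialTerm; theorem)
      T : Vector Carrier s
      T i = binomialTerm s (fsuc i)
      yˢ≈1+ΣT : y ^ s ≈ 1# + sum T
      yˢ≈1+ΣT = begin
        y ^ s                        ≈⟨ ^-congˡ s (//-rightDividesˡ 1# y) ⟨
        (a + 1#) ^ s                 ≈⟨ theorem (trans (*-identityʳ a) (sym (*-identityˡ a))) s ⟩
        binomialTerm s fzero + sum T ≈⟨ +-congʳ (trans (+-identityʳ _) (trans (*-identityˡ _) (1#^n≈1# s))) ⟩
        1# + sum T                   ∎
      ΣT≈yˢ-1 : sum T ≈ y ^ s - 1#
      ΣT≈yˢ-1 = begin
        sum T             ≈⟨ //-rightDividesʳ 1# (sum T) ⟨
        (sum T + 1#) - 1# ≈⟨ +-congʳ (+-comm (sum T) 1#) ⟩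
        (1# + sum T) - 1# ≈⟨ +-congʳ yˢ≈1+ΣT ⟨
        y ^ s - 1#        ∎

  module _ {ℓ'} {k : ℕ} {N : ℕ → Pred Carrier ℓ'} (cnc : CNC k N) {s : ℕ → ℕ}
           (chars : ∀ i → 1 ≤ i → i < k → IsCharacteristic (N i) (N (suc i)) (s i)) where
    open CNC cnc using (k≥1; ideal; Nk-zero)

    PowOneMod-climb : ∀ x w → PowOneMod (N 1) x w →
                      ∀ d → suc d ≤ k → PowOneMod (N (suc d)) x (w ℕ* ∏₁ s d)
    PowOneMod-climb x w xʷ-1∈N₁ zero    _   =
      IsIdeal.resp (ideal 1 ℕ.≤-refl k≥1) (+-congʳ (^-congʳ x (≡.sym (ℕ.*-identityʳ w)))) xʷ-1∈N₁
    PowOneMod-climb x w xʷ-1∈N₁ (suc d) 2+d≤k =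
      IsIdeal.resp (ideal (2 ℕ.+ d) (ℕ.s≤s ℕ.z≤n) 2+d≤k) (+-congʳ xᵁ^sᵢ≈xᵁsᵢ)
        (y-1∈N⇒yˢ-1∈M (ideal (suc d) (ℕ.s≤s ℕ.z≤n) 1+d≤k) (ideal (2 ℕ.+ d) (ℕ.s≤s ℕ.z≤n) 2+d≤k)
                       pow⊆ s⊆ primes (PowOneMod-climb x w xʷ-1∈N₁ d 1+d≤k))
      where
      1+d≤k : suc d ≤ k
      1+d≤k = ℕ.≤-trans (ℕ.n≤1+n (suc d)) 2+d≤k
      open IsCharacteristic (chars (suc d) (ℕ.s≤s ℕ.z≤n) 2+d≤k) using (nilIdx; s⊆; primes)
      open IsNilIndex nilIdx using (pow⊆)
      U : ℕ
      U = w ℕ* ∏₁ s d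
      xᵁ^sᵢ≈xᵁsᵢ : (x ^ U) ^ s (suc d) ≈ x ^ (w ℕ* ∏₁ s (suc d))
      xᵁ^sᵢ≈xᵁsᵢ = trans (^-assocʳ x U (s (suc d))) (^-congʳ x (ℕ.*-assoc w (∏₁ s d) (s (suc d))))

    ^∏-characteristics≈1# : ∀ x w → PowOneMod (N 1) x w → x ^ (w ℕ* ∏₁ s (k ∸ 1)) ≈ 1#
    ^∏-characteristics≈1# x w xʷ-1∈N₁ = x∙y⁻¹≈ε⇒x≈y (x ^ W) 1# (Nk-zero (x ^ W - 1#) xᵂ-1∈Nₖ)
      where
      W : ℕ
      W = w ℕ* ∏₁ s (k ∸ 1)
      suc[k∸1]≡k : ∀ {k} → 1 ≤ k → suc (k ∸ 1) ≡ k
      suc[k∸1]≡k (ℕ.s≤s _) = ≡.refl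
      xᵂ-1∈Nₖ : N k (x ^ W - 1#)
      xᵂ-1∈Nₖ = ≡.subst (λ i → N i (x ^ W - 1#)) (suc[k∸1]≡k k≥1)
                  (PowOneMod-climb x w xʷ-1∈N₁ (k ∸ 1) (ℕ.≤-reflexive (suc[k∸1]≡k k≥1)))

  order∣ : ∀ {x W m} → x ^ W ≈ 1# → IsOrder x m → m ∣ W
  order∣ {x} {W} {m} xᵂ≈1 order = m%n≡0⇒n∣m W m W%m≡0
    where
    open IsOrder order
    instance
      m-nonZero : NonZero m
      m-nonZero = ℕ.>-nonZero m≥1
    x^[q*m]≈1 : ∀ q → x ^ (q ℕ* m) ≈ 1#
    x^[q*m]≈1 q = begin
      x ^ (q ℕ* m)  ≈⟨ ^-congʳ x (ℕ.*-comm q m) ⟩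
      x ^ (m ℕ* q)  ≈⟨ ^-assocʳ x m q ⟨
      (x ^ m) ^ q   ≈⟨ ^-congˡ q pow1 ⟩
      1# ^ q        ≈⟨ 1#^n≈1# q ⟩
      1#            ∎
    x^[W%m]≈1 : x ^ (W % m) ≈ 1#
    x^[W%m]≈1 = begin
      x ^ (W % m)                   ≈⟨ *-identityʳ _ ⟨
      x ^ (W % m) * 1#              ≈⟨ *-congˡ (x^[q*m]≈1 (W / m)) ⟨
      x ^ (W % m) * x ^ (W / m ℕ* m) ≈⟨ ^-homo-* x (W % m) (W / m ℕ* m) ⟨
      x ^ (W % m ℕ.+ W / m ℕ* m)    ≈⟨ ^-congʳ x (m≡m%n+[m/n]*n W m) ⟨
      x ^ W                         ≈⟨ xᵂ≈1 ⟩
      1#                            ∎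
    W%m≡0 : W % m ≡ 0
    W%m≡0 = ℕ.n≤0⇒n≡0 (ℕ.≮⇒≥ λ 0<W%m → ℕ.<⇒≱ (m%n<n W m) (least (W % m) 0<W%m x^[W%m]≈1))

theorem3p1 : ∀ {c ℓ ℓ'} (R : Ring c ℓ) → let open RingDefs R in
    (k : ℕ) (N : ℕ → Pred Carrier ℓ') → CNC k N →
    (s : ℕ → ℕ) → (∀ i → 1 ≤ i → i < k → IsCharacteristic (N i) (N (suc i)) (s i)) →
    (w : ℕ) (f : Carrier) → PowOneMod (N 1) f w →
    (∀ x → InCoset (N 1) f x → x ^ (w ℕ* ∏₁ s (k ∸ 1)) ≈ 1#)
    × (IsOrderMod (N 1) f w →
       ∀ x → InCoset (N 1) f x → ∀ m → IsOrder x m → m ∣ w ℕ* ∏₁ s (k ∸ 1))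
theorem3p1 R k N cnc s chars w f fʷ-1∈N₁ = xᵂ≈1 , λ _ x x∈f+N₁ m order → order∣ R (xᵂ≈1 x x∈f+N₁) order
  where
  open RingDefs R using (IsIdeal; InCoset; _^_; _≈_; 1#; module CNC)
  N₁-ideal : IsIdeal (N 1)
  N₁-ideal = CNC.ideal cnc 1 ℕ.≤-refl (CNC.k≥1 cnc)
  xᵂ≈1 : ∀ x → InCoset (N 1) f x → x ^ (w ℕ* ∏₁ s (k ∸ 1)) ≈ 1#
  xᵂ≈1 x x∈f+N₁ = ^∏-characteristics≈1# R cnc chars x w (PowOneMod-coset R N₁-ideal w fʷ-1∈N₁ x∈f+N₁)
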